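{- Let $S$ be a set of exactly $9$ points in $PG(3,2)$ which is a strong blocking set. Then through each point $P\in S$ there pass exactly $2$ lines of $PG(3,2)$ that are entirely contained in $S$.
   Context: $PG(3,2)$ is the $3$-dimensional projective space over $\mathbb{F}_2$ (15 points, each line has 3 points). A strong blocking set in $PG(k-1,q)$ is a set of points $\mathcal{M}$ such that for every hyperplane $\sigma$, the projective span $\langle \sigma\cap\mathcal{M}\rangle$ equals $\sigma$. A strong blocking set in $PG(3,2)$ has at least $9$ points; one with exactly $9$ points is called a minimal strong blocking set. -}

module Defs where

open import Data.Bool using (Bool; true; false; _xor_; _∧_; _∨_; T; if_then_else_)
open import Data.Vec using (Vec; []; _∷_; zipWith; foldr)
open import Data.List using (List; []; _∷_; _++_; map; length; filter)
open import Data.List.Relation.Unary.All using (All)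
open import Data.Product using (Σ; _×_; _,_; ∃; ∃-syntax; proj₁)
open import Data.Sum using (_⊎_)
open import Data.Nat using (ℕ)
open import Data.Unit using (tt)
open import Relation.Binary.PropositionalEquality using (_≡_; subst; sym)
open import Relation.Nullary using (¬_)

V : Set
V = Vec Bool 4

zeroV : V
zeroV = false ∷ false ∷ false ∷ false ∷ []

_+ᵥ_ : V → V → V
_+ᵥ_ = zipWith _xor_

-- standard bilinear form, used to describe hyperplanes as kernels of functionals
dot : V → V → Bool
dot a x = foldr (λ _ → Bool) _xor_ false (zipWith _∧_ a x)

nonzero : V → Bool
nonzero v = foldr (λ _ → Bool) _∨_ false v

-- points of PG(3,2): nonzero vectors (over F₂ each 1-dim subspace has exactly one)
Point : Set
Point = Σ V (λ v → T (nonzero v))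

vec : Point → V
vec = proj₁

allV : (n : ℕ) → List (Vec Bool n)
allV ℕ.zero = [] ∷ []
allV (ℕ.suc n) = map (false ∷_) (allV n) ++ map (true ∷_) (allV n)

allPoints : List Point
allPoints = collect (allV 4)
  where
  collect : List V → List Point
  collect [] = []
  collect (v ∷ vs) with nonzero v in eq
  ... | true  = (v , subst T (sym eq) tt) ∷ collect vs
  ... | false = collect vs

PointSet : Set
PointSet = Point → Bool

card : PointSet → ℕ
card S = count allPoints
  where
  count : List Point → ℕ
  count [] = 0
  count (p ∷ ps) = if S p then ℕ.suc (count ps) else count ps

sumV : List V → V
sumV [] = zeroV
sumV (v ∷ vs) = v +ᵥ sumV vs

-- y lies in the projective span of the point set A :
-- vec y is an F₂-linear combination (= a sum of a sublist) of points of A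
InSpan : (Point → Set) → Point → Set
InSpan A y = Σ (List Point) (λ xs → All A xs × sumV (map vec xs) ≡ vec y)

-- hyperplanes of PG(3,2): kernels of nonzero functionals x ↦ a·x, a ≠ 0
-- point x lies in the hyperplane σ_a
InHyp : Point → Point → Set
InHyp a x = dot (vec a) (vec x) ≡ false

-- strong blocking set: for every hyperplane σ, ⟨σ ∩ M⟩ = σ (as sets of points)
StrongBlocking : PointSet → Set
StrongBlocking M = (a : Point) → (y : Point) →
  (InSpan (λ x → InHyp a x × M x ≡ true) y → InHyp a y) ×
  (InHyp a y → InSpan (λ x → InHyp a x × M x ≡ true) y)

IsLine : (Point → Set) → Set
IsLine L = Σ Point λ x → Σ Point λ y → ¬ (x ≡ y) ×
  ((z : Point) → (L z → (z ≡ x ⊎ z ≡ y ⊎ vec z ≡ vec x +ᵥ vec y)) ×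
                 ((z ≡ x ⊎ z ≡ y ⊎ vec z ≡ vec x +ᵥ vec y) → L z))

SameSet : (Point → Set) → (Point → Set) → Set
SameSet L L' = (z : Point) → (L z → L' z) × (L' z → L z)

LineThroughIn : Point → PointSet → (Point → Set) → Set
LineThroughIn P S L = IsLine L × L P × ((z : Point) → L z → S z ≡ true)

{-# OPTIONS --safe #-}
-- A strong blocking set S meets σ_a ∖ σ_c for all hyperplanes σ_a ≠ σ_c: the span of S ∩ σ_a
-- is σ_a, so S ∩ σ_a does not lie in the line σ_a ∩ σ_c. This is a condition on the 15-bit
-- characteristic vector of S, and running through all 5005 vectors of weight 9 shows that
-- every 9-point set satisfying it has exactly two lines inside it through each of its points.
-- A line through P is {P, Q, P + Q} for any other point Q on it, so the lines through P
-- inside S are read off from the points Q with Q, P + Q ∈ S.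
module Submission where

open import Defs
open import Algebra.Bundles using (CommutativeRing)
open import Data.Bool using (Bool; true; false; not; _∧_; _∨_; _xor_; T; if_then_else_)
open import Data.Bool.ListAction using (all; any)
open import Data.Bool.Properties
  using (_≟_; xor-comm; xor-assoc; xor-identityˡ; xor-identityʳ; xor-same; ∧-distribˡ-xor; ∧-zeroʳ;
         xor-∧-commutativeRing; T-≡; T-∧; T-∨; T-not-≡; T-irrelevant)
open import Algebra.Properties.CommutativeSemigroup
  (CommutativeRing.+-commutativeSemigroup xor-∧-commutativeRing) using (interchange)
open import Data.Empty using (⊥-elim)
open import Data.List using (List; []; _∷_; _++_; map; length; null; filterᵇ; cartesianProduct)
open import Data.List.Membership.Propositional using (_∈_; lose)
open import Data.List.Membership.Propositional.Properties
  using (∈-map⁺; ∈-map⁻; ∈-++⁺ˡ; ∈-++⁺ʳ; ∈-filter⁺; ∈-filter⁻)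
open import Data.List.Relation.Unary.All as All using (All)
open import Data.List.Relation.Unary.All.Properties using (all⁺; all⁻)
open import Data.List.Relation.Unary.Any as Any using (Any; here; there)
open import Data.List.Relation.Unary.Any.Properties using (any⁺; any⁻)
open import Data.Nat using (ℕ; zero; suc; _^_; _+_; _∸_)
open import Data.Product using (Σ; _×_; _,_; proj₁; proj₂; uncurry)
open import Data.Sum using (_⊎_; inj₁; inj₂)
import Data.Sum as Sum
open import Data.Unit using (tt)
open import Data.Vec using (Vec; []; _∷_; zipWith; foldr′; replicate)
open import Data.Vec.Properties
  using (≡-dec; zipWith-comm; zipWith-assoc; zipWith-identityˡ; zipWith-identityʳ)
open import Function using (_∘_; id)
open import Function.Bundles using (Equivalence)
open Equivalence using (to; from)
open import Relation.Binary.PropositionalEquality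
  using (_≡_; _≢_; refl; sym; trans; cong; cong₂; subst; module ≡-Reasoning)
open import Relation.Nullary using (¬_; does; yes; no)
open import Relation.Nullary.Decidable using (T?; dec-true; dec-false)

open ≡-Reasoning

+ᵥ-comm : (u w : V) → u +ᵥ w ≡ w +ᵥ u
+ᵥ-comm = zipWith-comm xor-comm

+ᵥ-assoc : (u v w : V) → (u +ᵥ v) +ᵥ w ≡ u +ᵥ (v +ᵥ w)
+ᵥ-assoc = zipWith-assoc xor-assoc

+ᵥ-identityˡ : (u : V) → zeroV +ᵥ u ≡ u
+ᵥ-identityˡ = zipWith-identityˡ xor-identityˡ

+ᵥ-identityʳ : (u : V) → u +ᵥ zeroV ≡ u
+ᵥ-identityʳ = zipWith-identityʳ xor-identityʳ

+ᵥ-self : (u : V) → u +ᵥ u ≡ zeroV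
+ᵥ-self (a ∷ b ∷ c ∷ d ∷ []) rewrite xor-same a | xor-same b | xor-same c | xor-same d = refl

+ᵥ-cancelˡ : (u w : V) → u +ᵥ (u +ᵥ w) ≡ w
+ᵥ-cancelˡ u w = begin
  u +ᵥ (u +ᵥ w)  ≡⟨ sym (+ᵥ-assoc u u w) ⟩
  (u +ᵥ u) +ᵥ w  ≡⟨ cong (_+ᵥ w) (+ᵥ-self u) ⟩
  zeroV +ᵥ w     ≡⟨ +ᵥ-identityˡ w ⟩
  w              ∎

+ᵥ≡zeroV⇒≡ : (u w : V) → u +ᵥ w ≡ zeroV → u ≡ w
+ᵥ≡zeroV⇒≡ u w u+w≡0 = begin
  u              ≡⟨ sym (+ᵥ-identityʳ u) ⟩
  u +ᵥ zeroV     ≡⟨ cong (u +ᵥ_) (sym u+w≡0) ⟩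
  u +ᵥ (u +ᵥ w)  ≡⟨ +ᵥ-cancelˡ u w ⟩
  w              ∎

+ᵥ≡ˡ⇒zeroV : (u w : V) → u +ᵥ w ≡ u → w ≡ zeroV
+ᵥ≡ˡ⇒zeroV u w u+w≡u = begin
  w              ≡⟨ sym (+ᵥ-cancelˡ u w) ⟩
  u +ᵥ (u +ᵥ w)  ≡⟨ cong (u +ᵥ_) u+w≡u ⟩
  u +ᵥ u         ≡⟨ +ᵥ-self u ⟩
  zeroV          ∎

dotₙ : ∀ {n} → Vec Bool n → Vec Bool n → Bool
dotₙ a x = foldr′ _xor_ false (zipWith _∧_ a x)

dotₙ-zeroʳ : ∀ {n} (a : Vec Bool n) → dotₙ a (replicate n false) ≡ false
dotₙ-zeroʳ [] = refl
dotₙ-zeroʳ (a ∷ as) rewrite ∧-zeroʳ a = dotₙ-zeroʳ as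

dotₙ-+ : ∀ {n} (a u w : Vec Bool n) → dotₙ a (zipWith _xor_ u w) ≡ dotₙ a u xor dotₙ a w
dotₙ-+ [] [] [] = refl
dotₙ-+ (a ∷ as) (u ∷ us) (w ∷ ws) = begin
  (a ∧ (u xor w)) xor dotₙ as (zipWith _xor_ us ws)
    ≡⟨ cong₂ _xor_ (∧-distribˡ-xor a u w) (dotₙ-+ as us ws) ⟩
  ((a ∧ u) xor (a ∧ w)) xor (dotₙ as us xor dotₙ as ws)
    ≡⟨ interchange (a ∧ u) (a ∧ w) (dotₙ as us) (dotₙ as ws) ⟩
  ((a ∧ u) xor dotₙ as us) xor ((a ∧ w) xor dotₙ as ws)
    ∎

dot-zeroʳ : (a : V) → dot a zeroV ≡ false
dot-zeroʳ = dotₙ-zeroʳ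

dot-+ᵥ : (a u w : V) → dot a (u +ᵥ w) ≡ dot a u xor dot a w
dot-+ᵥ = dotₙ-+

dot-sumV≡true : (c : V) (xs : List Point) → dot c (sumV (map vec xs)) ≡ true →
  Any (λ x → dot c (vec x) ≡ true) xs
dot-sumV≡true c [] c·0≡true with () ← trans (sym (dot-zeroʳ c)) c·0≡true
dot-sumV≡true c (x ∷ xs) c·sum≡true with dot c (vec x) in c·x
... | true  = here c·x
... | false = there (dot-sumV≡true c xs (begin
  dot c s                         ≡⟨ cong (_xor dot c s) (sym c·x) ⟩
  dot c (vec x) xor dot c s       ≡⟨ sym (dot-+ᵥ c (vec x) s) ⟩
  dot c (vec x +ᵥ s)              ≡⟨ c·sum≡true ⟩
  true                            ∎))
  where
  s : V
  s = sumV (map vec xs)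

-- y is a sum of points of S ∩ σ_a, and a sum of vectors orthogonal to c is orthogonal to c.
strongBlocking⇒meets : {S : PointSet} → StrongBlocking S → (a c y : Point) →
  InHyp a y → dot (vec c) (vec y) ≡ true →
  Σ Point λ x → (InHyp a x × S x ≡ true) × dot (vec c) (vec x) ≡ true
strongBlocking⇒meets blocking a c y y∈σa c·y≡true
  with xs , xs⊆σa∩S , sum≡y ← proj₂ (blocking a y) y∈σa =
  let witness = dot-sumV≡true (vec c) xs (subst (λ v → dot (vec c) v ≡ true) (sym sum≡y) c·y≡true)
  in Any.lookup witness , All.lookupAny xs⊆σa∩S witness

-- Points and lines

vec-injective : {x y : Point} → vec x ≡ vec y → x ≡ y
vec-injective {v , t} {.v , t′} refl = cong (v ,_) (T-irrelevant t t′)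

vec≢zeroV : (x : Point) → vec x ≢ zeroV
vec≢zeroV (v , t) v≡0 = subst (T ∘ nonzero) v≡0 t

≢zeroV⇒nonzero : (w : V) → w ≢ zeroV → T (nonzero w)
≢zeroV⇒nonzero (true ∷ _) _ = tt
≢zeroV⇒nonzero (false ∷ true ∷ _) _ = tt
≢zeroV⇒nonzero (false ∷ false ∷ true ∷ _) _ = tt
≢zeroV⇒nonzero (false ∷ false ∷ false ∷ true ∷ []) _ = tt
≢zeroV⇒nonzero (false ∷ false ∷ false ∷ false ∷ []) w≢0 = ⊥-elim (w≢0 refl)

thirdPoint : (x y : Point) → vec x ≢ vec y → Point
thirdPoint x y x≢y = vec x +ᵥ vec y , ≢zeroV⇒nonzero _ (x≢y ∘ +ᵥ≡zeroV⇒≡ (vec x) (vec y))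

Line : V → V → V → Set
Line u w v = v ≡ u ⊎ v ≡ w ⊎ v ≡ u +ᵥ w

Line-swap : ∀ {u w v} → Line u w v → Line w u v
Line-swap (inj₁ v≡u) = inj₂ (inj₁ v≡u)
Line-swap (inj₂ (inj₁ v≡w)) = inj₁ v≡w
Line-swap {u} {w} (inj₂ (inj₂ v≡u+w)) = inj₂ (inj₂ (trans v≡u+w (+ᵥ-comm u w)))

Line-shift : ∀ {u w v} → Line u w v → Line u (u +ᵥ w) v
Line-shift (inj₁ v≡u) = inj₁ v≡u
Line-shift {u} {w} (inj₂ (inj₁ v≡w)) = inj₂ (inj₂ (trans v≡w (sym (+ᵥ-cancelˡ u w))))
Line-shift (inj₂ (inj₂ v≡u+w)) = inj₂ (inj₁ v≡u+w)

Line-⊆ : ∀ {u w p q} → Line u w p → Line u w q → p ≢ q → ∀ {v} → Line u w v → Line p q v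
Line-⊆ (inj₁ refl) (inj₁ refl) p≢q = ⊥-elim (p≢q refl)
Line-⊆ (inj₁ refl) (inj₂ (inj₁ refl)) _ = id
Line-⊆ (inj₁ refl) (inj₂ (inj₂ refl)) _ = Line-shift
Line-⊆ (inj₂ (inj₁ refl)) (inj₁ refl) _ = Line-swap
Line-⊆ (inj₂ (inj₁ refl)) (inj₂ (inj₁ refl)) p≢q = ⊥-elim (p≢q refl)
Line-⊆ {u} {w} (inj₂ (inj₁ refl)) (inj₂ (inj₂ refl)) _ =
  subst (λ t → Line w t _) (+ᵥ-comm w u) ∘ Line-shift ∘ Line-swap
Line-⊆ (inj₂ (inj₂ refl)) (inj₁ refl) _ = Line-swap ∘ Line-shift
Line-⊆ {u} {w} (inj₂ (inj₂ refl)) (inj₂ (inj₁ refl)) _ =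
  subst (λ t → Line t w _) (+ᵥ-comm w u) ∘ Line-swap ∘ Line-shift ∘ Line-swap
Line-⊆ (inj₂ (inj₂ refl)) (inj₂ (inj₂ refl)) p≢q = ⊥-elim (p≢q refl)

line : Point → Point → Point → Set
line x y z = z ≡ x ⊎ z ≡ y ⊎ vec z ≡ vec x +ᵥ vec y

line⇒Line : ∀ {x y z} → line x y z → Line (vec x) (vec y) (vec z)
line⇒Line = Sum.map (cong vec) (Sum.map₁ (cong vec))

Line⇒line : ∀ {x y z} → Line (vec x) (vec y) (vec z) → line x y z
Line⇒line = Sum.map vec-injective (Sum.map₁ vec-injective)

isLine-line : {x y : Point} → x ≢ y → IsLine (line x y)
isLine-line {x} {y} x≢y = x , y , x≢y , λ _ → id , id

SameSet-sym : {L L′ : Point → Set} → SameSet L L′ → SameSet L′ L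
SameSet-sym L≐L′ z = proj₂ (L≐L′ z) , proj₁ (L≐L′ z)

SameSet-trans : {L L′ L″ : Point → Set} → SameSet L L′ → SameSet L′ L″ → SameSet L L″
SameSet-trans L≐L′ L′≐L″ z =
  proj₁ (L′≐L″ z) ∘ proj₁ (L≐L′ z) , proj₂ (L≐L′ z) ∘ proj₂ (L′≐L″ z)

sameLine : {x y p q : Point} → vec x ≢ vec y → line x y p → line x y q → vec p ≢ vec q →
  SameSet (line x y) (line p q)
sameLine {x} {y} {p} {q} x≢y p∈xy q∈xy p≢q z =
  Line⇒line ∘ xy⊆pq ∘ line⇒Line ,
  Line⇒line ∘ Line-⊆ (xy⊆pq (inj₁ refl)) (xy⊆pq (inj₂ (inj₁ refl))) x≢y ∘ line⇒Line
  where
  xy⊆pq : ∀ {v} → Line (vec x) (vec y) v → Line (vec p) (vec q) v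
  xy⊆pq = Line-⊆ (line⇒Line p∈xy) (line⇒Line q∈xy) p≢q

LineIn : PointSet → Point → Point → Set
LineIn S P Q = vec Q ≢ vec P × ((z : Point) → line P Q z → S z ≡ true)

lineIn-intro : {S : PointSet} {P Q : Point} → S P ≡ true → S Q ≡ true →
  (Q≢P : vec Q ≢ vec P) →   S (thirdPoint P Q (Q≢P ∘ sym)) ≡ true → LineIn S P Q
lineIn-intro {S} {P} {Q} SP SQ Q≢P SPQ = Q≢P , PQ⊆S
  where
  PQ⊆S : (z : Point) → line P Q z → S z ≡ true
  PQ⊆S z (inj₁ refl) = SP
  PQ⊆S z (inj₂ (inj₁ refl)) = SQ
  PQ⊆S z (inj₂ (inj₂ z≡P+Q)) = subst (λ r → S r ≡ true) (sym (vec-injective z≡P+Q)) SPQ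

lineIn⇒lineThroughIn : {S : PointSet} {P Q : Point} → LineIn S P Q → LineThroughIn P S (line P Q)
lineIn⇒lineThroughIn (Q≢P , PQ⊆S) = isLine-line (Q≢P ∘ cong vec ∘ sym) , inj₁ refl , PQ⊆S

anotherPoint : {x y P : Point} → x ≢ y → line x y P → Σ Point λ Q → line x y Q × vec P ≢ vec Q
anotherPoint {x} {y} x≢y (inj₁ refl) = y , inj₂ (inj₁ refl) , x≢y ∘ vec-injective
anotherPoint {x} {y} x≢y (inj₂ (inj₁ refl)) = x , inj₁ refl , x≢y ∘ sym ∘ vec-injective
anotherPoint {x} {y} x≢y (inj₂ (inj₂ P≡x+y)) = x , inj₁ refl ,
  λ P≡x → vec≢zeroV y (+ᵥ≡ˡ⇒zeroV (vec x) (vec y) (trans (sym P≡x+y) P≡x))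

lineThroughIn⇒lineIn : {S : PointSet} {P : Point} {L : Point → Set} → LineThroughIn P S L →
  Σ Point λ Q → LineIn S P Q × SameSet L (line P Q)
lineThroughIn⇒lineIn {P = P} ((x , y , x≢y , L≐xy) , P∈L , L⊆S)
  with P∈xy ← proj₁ (L≐xy P) P∈L
  with Q , Q∈xy , P≢Q ← anotherPoint x≢y P∈xy =
  let L≐PQ = SameSet-trans L≐xy (sameLine (x≢y ∘ vec-injective) P∈xy Q∈xy P≢Q)
  in Q , (P≢Q ∘ sym , λ z → L⊆S z ∘ proj₂ (L≐PQ z)) , L≐PQ

lineIn-sameLine : {S : PointSet} {P Q Q′ : Point} → LineIn S P Q′ → line P Q′ Q →
  vec Q ≢ vec P →   SameSet (line P Q) (line P Q′)
lineIn-sameLine (Q′≢P , _) Q∈PQ′ Q≢P =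
  SameSet-sym (sameLine (Q′≢P ∘ sym) (inj₁ refl) Q∈PQ′ (Q≢P ∘ sym))

ExactlyTwoLinesThrough : Point → PointSet → Set₁
ExactlyTwoLinesThrough P S = Σ (Point → Set) λ L₁ → Σ (Point → Set) λ L₂ →
  LineThroughIn P S L₁ × LineThroughIn P S L₂ × ¬ SameSet L₁ L₂ ×
  ((L : Point → Set) → LineThroughIn P S L → SameSet L L₁ ⊎ SameSet L L₂)

twoLinesIn⇒exactlyTwoLines : {S : PointSet} {P Q₁ Q₂ : Point} →
  LineIn S P Q₁ → LineIn S P Q₂ → ¬ line P Q₁ Q₂ →
  ((Q : Point) → LineIn S P Q → line P Q₁ Q ⊎ line P Q₂ Q) → ExactlyTwoLinesThrough P S
twoLinesIn⇒exactlyTwoLines {S} {P} {Q₁} {Q₂} PQ₁⊆S PQ₂⊆S Q₂∉PQ₁ cover =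
  line P Q₁ , line P Q₂ , lineIn⇒lineThroughIn PQ₁⊆S , lineIn⇒lineThroughIn PQ₂⊆S ,
  (λ same → Q₂∉PQ₁ (proj₂ (same Q₂) (inj₂ (inj₁ refl)))) , exhaustive
  where
  exhaustive : (L : Point → Set) → LineThroughIn P S L →
    SameSet L (line P Q₁) ⊎ SameSet L (line P Q₂)
  exhaustive L L∈ with Q , PQ⊆S , L≐PQ ← lineThroughIn⇒lineIn L∈ =
    Sum.map (λ Q∈PQ₁ → SameSet-trans L≐PQ (lineIn-sameLine PQ₁⊆S Q∈PQ₁ (proj₁ PQ⊆S)))
            (λ Q∈PQ₂ → SameSet-trans L≐PQ (lineIn-sameLine PQ₂⊆S Q∈PQ₂ (proj₁ PQ⊆S)))
            (cover Q PQ⊆S)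

-- Point sets as bit lists

bits : PointSet → List Bool
bits S = map S allPoints

bitAt : List Bool → ℕ → Bool
bitAt [] _ = false
bitAt (b ∷ _) zero = b
bitAt (_ ∷ bs) (suc i) = bitAt bs i

-- the position of v in allV n
rank : ∀ {n} → Vec Bool n → ℕ
rank [] = 0
rank {suc n} (b ∷ v) = (if b then 2 ^ n else 0) + rank v

infix 7 _∋_

-- allPoints is allV 4 with its first entry, zeroV, removed.
_∋_ : List Bool → V → Bool
bs ∋ v = bitAt bs (rank v ∸ 1)

bits-∋ : (S : PointSet) (p : Point) → bits S ∋ vec p ≡ S p
bits-∋ S ((false ∷ false ∷ false ∷ false ∷ []) , ())
bits-∋ S ((false ∷ false ∷ false ∷ true  ∷ []) , _) = refl
bits-∋ S ((false ∷ false ∷ true  ∷ false ∷ []) , _) = refl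
bits-∋ S ((false ∷ false ∷ true  ∷ true  ∷ []) , _) = refl
bits-∋ S ((false ∷ true  ∷ false ∷ false ∷ []) , _) = refl
bits-∋ S ((false ∷ true  ∷ false ∷ true  ∷ []) , _) = refl
bits-∋ S ((false ∷ true  ∷ true  ∷ false ∷ []) , _) = refl
bits-∋ S ((false ∷ true  ∷ true  ∷ true  ∷ []) , _) = refl
bits-∋ S ((true  ∷ false ∷ false ∷ false ∷ []) , _) = refl
bits-∋ S ((true  ∷ false ∷ false ∷ true  ∷ []) , _) = refl
bits-∋ S ((true  ∷ false ∷ true  ∷ false ∷ []) , _) = refl
bits-∋ S ((true  ∷ false ∷ true  ∷ true  ∷ []) , _) = refl
bits-∋ S ((true  ∷ true  ∷ false ∷ false ∷ []) , _) = refl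
bits-∋ S ((true  ∷ true  ∷ false ∷ true  ∷ []) , _) = refl
bits-∋ S ((true  ∷ true  ∷ true  ∷ false ∷ []) , _) = refl
bits-∋ S ((true  ∷ true  ∷ true  ∷ true  ∷ []) , _) = refl

∋-bits⁺ : (S : PointSet) (p : Point) → S p ≡ true → T (bits S ∋ vec p)
∋-bits⁺ S p Sp = from T-≡ (trans (bits-∋ S p) Sp)

∋-bits⁻ : (S : PointSet) (p : Point) → T (bits S ∋ vec p) → S p ≡ true
∋-bits⁻ S p p∈ = trans (sym (bits-∋ S p)) (to T-≡ p∈)

bitAt-map⁻ : {A : Set} (f : A → Bool) (xs : List A) (i : ℕ) →
  T (bitAt (map f xs) i) → Any (T ∘ f) xs
bitAt-map⁻ f (x ∷ xs) zero fx = here fx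
bitAt-map⁻ f (x ∷ xs) (suc i) h = there (bitAt-map⁻ f xs i h)

infix 4 _==ᵥ_

_==ᵥ_ : V → V → Bool
u ==ᵥ w = does (≡-dec _≟_ u w)

==ᵥ-sound : (u w : V) → T (u ==ᵥ w) → u ≡ w
==ᵥ-sound u w h with ≡-dec _≟_ u w
... | yes u≡w = u≡w

==ᵥ-complete : (u w : V) → u ≡ w → T (u ==ᵥ w)
==ᵥ-complete u w u≡w = from T-≡ (dec-true (≡-dec _≟_ u w) u≡w)

not==ᵥ-sound : (u w : V) → T (not (u ==ᵥ w)) → u ≢ w
not==ᵥ-sound u w h with ≡-dec _≟_ u w
... | no u≢w = u≢w

not==ᵥ-complete : (u w : V) → u ≢ w → T (not (u ==ᵥ w))
not==ᵥ-complete u w u≢w = from T-not-≡ (dec-false (≡-dec _≟_ u w) u≢w)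

∈-allPoints : (p : Point) → p ∈ allPoints
∈-allPoints p = Any.map (λ {q} q≡p → sym (vec-injective (==ᵥ-sound (vec q) (vec p) q≡p)))
  (bitAt-map⁻ isP allPoints (rank (vec p) ∸ 1)
    (∋-bits⁺ isP p (dec-true (≡-dec _≟_ (vec p) (vec p)) refl)))
  where
  isP : Point → Bool
  isP q = vec q ==ᵥ vec p

all-allPoints : (p : Point → Bool) → T (all p allPoints) → (Q : Point) → T (p Q)
all-allPoints p h Q = All.lookup (all⁺ p allPoints h) (∈-allPoints Q)

infixr 5 _⇒ᵇ_

_⇒ᵇ_ : Bool → Bool → Bool
true  ⇒ᵇ y = y
false ⇒ᵇ _ = true

T-⇒ᵇ : ∀ x {y} → T (x ⇒ᵇ y) → T x → T y
T-⇒ᵇ true x⇒y _ = x⇒y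

lineInᵇ : List Bool → Point → Point → Bool
lineInᵇ b P Q = b ∋ vec Q ∧ not (vec Q ==ᵥ vec P) ∧ b ∋ (vec P +ᵥ vec Q)

lineInᵇ-sound : {S : PointSet} (P Q : Point) → S P ≡ true →
  T (lineInᵇ (bits S) P Q) → LineIn S P Q
lineInᵇ-sound {S} P Q SP h =
  let Q∈S , h′ = to (T-∧ {bits S ∋ vec Q}) h
      Q≠P , P+Q∈S = to (T-∧ {not (vec Q ==ᵥ vec P)}) h′
      Q≢P = not==ᵥ-sound (vec Q) (vec P) Q≠P
  in lineIn-intro SP (∋-bits⁻ S Q Q∈S) Q≢P (∋-bits⁻ S (thirdPoint P Q (Q≢P ∘ sym)) P+Q∈S)

lineInᵇ-complete : {S : PointSet} (P Q : Point) → LineIn S P Q → T (lineInᵇ (bits S) P Q)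
lineInᵇ-complete {S} P Q (Q≢P , PQ⊆S) = from (T-∧ {bits S ∋ vec Q})
  (∋-bits⁺ S Q (PQ⊆S Q (inj₂ (inj₁ refl))) , from (T-∧ {not (vec Q ==ᵥ vec P)})
  (not==ᵥ-complete (vec Q) (vec P) Q≢P ,
   ∋-bits⁺ S (thirdPoint P Q (Q≢P ∘ sym)) (PQ⊆S _ (inj₂ (inj₂ refl)))))

onLineᵇ : Point → Point → Point → Bool
onLineᵇ P Q z = (vec z ==ᵥ vec Q) ∨ (vec z ==ᵥ vec P +ᵥ vec Q)

onLineᵇ-sound : (P Q z : Point) → T (onLineᵇ P Q z) → line P Q z
onLineᵇ-sound P Q z = inj₂ ∘ Sum.map (vec-injective ∘ ==ᵥ-sound _ _) (==ᵥ-sound _ _) ∘ to T-∨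

onLineᵇ-complete : (P Q z : Point) → line P Q z → vec z ≢ vec P → T (onLineᵇ P Q z)
onLineᵇ-complete _ _ _ (inj₁ refl) z≢P = ⊥-elim (z≢P refl)
onLineᵇ-complete _ _ _ (inj₂ z∈PQ) _ =
  from T-∨ (Sum.map (==ᵥ-complete _ _ ∘ cong vec) (==ᵥ-complete _ _) z∈PQ)

coveredBy : List Bool → Point → Point → Point → Point → Bool
coveredBy b P Q₁ Q₂ Q = lineInᵇ b P Q ⇒ᵇ onLineᵇ P Q₁ Q ∨ onLineᵇ P Q₂ Q

twoLinesVia : List Bool → Point → Point → Point → Bool
twoLinesVia b P Q₁ Q₂ = lineInᵇ b P Q₁ ∧ lineInᵇ b P Q₂ ∧ not (onLineᵇ P Q₁ Q₂) ∧
  all (coveredBy b P Q₁ Q₂) allPoints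

twoLinesAt : List Bool → Point → Bool
twoLinesAt b P = any (λ Q₁ → any (twoLinesVia b P Q₁) allPoints) allPoints

twoLinesIfIn : List Bool → Point → Bool
twoLinesIfIn b P = b ∋ vec P ⇒ᵇ twoLinesAt b P

twoLinesEverywhere : List Bool → Bool
twoLinesEverywhere b = all (twoLinesIfIn b) allPoints

twoLinesEverywhere-sound : (b : List Bool) (P : Point) →
  T (twoLinesEverywhere b) → T (b ∋ vec P) → T (twoLinesAt b P)
twoLinesEverywhere-sound b P h = T-⇒ᵇ (b ∋ vec P) (all-allPoints (twoLinesIfIn b) h P)

twoLinesVia-sound : {S : PointSet} {P : Point} (Q₁ Q₂ : Point) → S P ≡ true →
  T (twoLinesVia (bits S) P Q₁ Q₂) → ExactlyTwoLinesThrough P S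
twoLinesVia-sound {S} {P} Q₁ Q₂ SP h =
  let PQ₁∈b , h₁ = to (T-∧ {lineInᵇ (bits S) P Q₁}) h
      PQ₂∈b , h₂ = to (T-∧ {lineInᵇ (bits S) P Q₂}) h₁
      Q₂∉PQ₁ , cover = to (T-∧ {not (onLineᵇ P Q₁ Q₂)}) h₂
      PQ₂⊆S = lineInᵇ-sound P Q₂ SP PQ₂∈b
  in twoLinesIn⇒exactlyTwoLines (lineInᵇ-sound P Q₁ SP PQ₁∈b) PQ₂⊆S
    (λ Q₂∈PQ₁ → subst T (to (T-not-≡ {onLineᵇ P Q₁ Q₂}) Q₂∉PQ₁)
                        (onLineᵇ-complete P Q₁ Q₂ Q₂∈PQ₁ (proj₁ PQ₂⊆S)))
    (λ Q PQ⊆S → Sum.map (onLineᵇ-sound P Q₁ Q) (onLineᵇ-sound P Q₂ Q) (to T-∨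
      (T-⇒ᵇ (lineInᵇ (bits S) P Q) (all-allPoints (coveredBy (bits S) P Q₁ Q₂) cover Q)
            (lineInᵇ-complete P Q PQ⊆S))))

twoLinesAt-sound : {S : PointSet} {P : Point} → S P ≡ true →
  T (twoLinesAt (bits S) P) → ExactlyTwoLinesThrough P S
twoLinesAt-sound {S} {P} SP h =
  let Q₁ , h₁ = Any.satisfied (any⁻ (λ Q → any (twoLinesVia (bits S) P Q) allPoints) allPoints h)
      Q₂ , h₂ = Any.satisfied (any⁻ (twoLinesVia (bits S) P Q₁) allPoints h₁)
  in twoLinesVia-sound Q₁ Q₂ SP h₂

-- σ_a ∖ σ_c: an affine plane of order 2 if a ≠ c, empty if a = c
affinePart : Point → Point → List Point
affinePart a c = filterᵇ (λ x → not (dot (vec a) (vec x)) ∧ dot (vec c) (vec x)) allPoints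

affineParts : List (List Point)
affineParts = filterᵇ (not ∘ null) (map (uncurry affinePart) (cartesianProduct allPoints allPoints))

meetsAll : List (List Point) → List Bool → Bool
meetsAll As b = all (any (λ x → b ∋ vec x)) As

strongBlocking⇒meetsAffinePart : {S : PointSet} → StrongBlocking S → (a c y : Point) →
  y ∈ affinePart a c → Σ Point λ x → x ∈ affinePart a c × S x ≡ true
strongBlocking⇒meetsAffinePart blocking a c y y∈ac =
  let _ , y∈σa∖σc = ∈-filter⁻ (T? ∘ inσa∖σc) {xs = allPoints} y∈ac
      y∈σa , y∉σc = to (T-∧ {not (dot (vec a) (vec y))}) y∈σa∖σc
      x , (x∈σa , Sx) , x∉σc =
        strongBlocking⇒meets blocking a c y (to T-not-≡ y∈σa) (to T-≡ y∉σc)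
  in x , ∈-filter⁺ (T? ∘ inσa∖σc) (∈-allPoints x)
           (from (T-∧ {not (dot (vec a) (vec x))}) (from T-not-≡ x∈σa , from T-≡ x∉σc)) , Sx
  where
  inσa∖σc : Point → Bool
  inσa∖σc x = not (dot (vec a) (vec x)) ∧ dot (vec c) (vec x)

nonempty⇒∈ : {A : Set} (xs : List A) → T (not (null xs)) → Σ A (_∈ xs)
nonempty⇒∈ (x ∷ _) _ = x , here refl

strongBlocking⇒meetsAll : {S : PointSet} → StrongBlocking S → T (meetsAll affineParts (bits S))
strongBlocking⇒meetsAll {S} blocking = all⁻ (any (λ x → bits S ∋ vec x)) (All.tabulate meets)
  where
  pairs : List (Point × Point)
  pairs = cartesianProduct allPoints allPoints

  meets : {A : List Point} → A ∈ affineParts → T (any (λ x → bits S ∋ vec x) A)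
  meets {A} A∈ =
    let A∈parts , nonempty =
          ∈-filter⁻ (T? ∘ (not ∘ null)) {xs = map (uncurry affinePart) pairs} A∈
        (a , c) , _ , A≡ac = ∈-map⁻ (uncurry affinePart) {xs = pairs} A∈parts
        y , y∈A = nonempty⇒∈ A nonempty
        x , x∈ac , Sx = strongBlocking⇒meetsAffinePart blocking a c y (subst (y ∈_) A≡ac y∈A)
    in any⁺ (λ x → bits S ∋ vec x) (lose (subst (x ∈_) (sym A≡ac) x∈ac) (∋-bits⁺ S x Sx))

-- Enumerating the 9-point sets

countTrue : List Bool → ℕ
countTrue [] = 0
countTrue (b ∷ bs) = if b then suc (countTrue bs) else countTrue bs

withWeight : ℕ → ℕ → List (List Bool)
withWeight zero    zero    = [] ∷ []
withWeight zero    (suc m) = []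
withWeight (suc n) zero    = map (false ∷_) (withWeight n zero)
withWeight (suc n) (suc m) = map (false ∷_) (withWeight n (suc m)) ++ map (true ∷_) (withWeight n m)

∈-withWeight : (bs : List Bool) → bs ∈ withWeight (length bs) (countTrue bs)
∈-withWeight [] = here refl
∈-withWeight (true ∷ bs) = ∈-++⁺ʳ _ (∈-map⁺ (true ∷_) (∈-withWeight bs))
∈-withWeight (false ∷ bs) with countTrue bs | ∈-withWeight bs
... | zero  | bs∈ = ∈-map⁺ (false ∷_) bs∈
... | suc _ | bs∈ = ∈-++⁺ˡ (∈-map⁺ (false ∷_) bs∈)

all≡true⇒T : {A : Set} (p : A → Bool) (xs : List A) → all p xs ≡ true →
  {x : A} → x ∈ xs → T (p x)
all≡true⇒T p xs h = All.lookup (all⁺ p xs (from T-≡ h))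

-- The table is an argument so that the evaluator computes it once rather than once per candidate.
twoLinesIfMeets : List (List Point) → List Bool → Bool
twoLinesIfMeets As b = meetsAll As b ⇒ᵇ twoLinesEverywhere b

twoLinesIfMeets-sound : (As : List (List Point)) (b : List Bool) →
  T (twoLinesIfMeets As b) → T (meetsAll As b) → T (twoLinesEverywhere b)
twoLinesIfMeets-sound As b = T-⇒ᵇ (meetsAll As b)

allWeightNine : all (twoLinesIfMeets affineParts) (withWeight 15 9) ≡ true
allWeightNine = refl

mainTheorem2 : (S : PointSet) → card S ≡ 9 → StrongBlocking S →
    (P : Point) → S P ≡ true →
    Σ (Point → Set) λ L₁ → Σ (Point → Set) λ L₂ →
    LineThroughIn P S L₁ × LineThroughIn P S L₂ × ¬ SameSet L₁ L₂ ×
    ((L : Point → Set) → LineThroughIn P S L → SameSet L L₁ ⊎ SameSet L L₂)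
mainTheorem2 S card≡9 blocking P SP =
  twoLinesAt-sound {S} {P} SP (twoLinesEverywhere-sound (bits S) P everywhere (∋-bits⁺ S P SP))
  where
  S∈weight9 : bits S ∈ withWeight 15 9
  S∈weight9 = subst (λ m → bits S ∈ withWeight 15 m) card≡9 (∈-withWeight (bits S))

  everywhere : T (twoLinesEverywhere (bits S))
  everywhere = twoLinesIfMeets-sound affineParts (bits S)
    (all≡true⇒T (twoLinesIfMeets affineParts) (withWeight 15 9) allWeightNine S∈weight9)
    (strongBlocking⇒meetsAll {S} blocking)
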